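{- Let $k\ge 1$. For $\mathbf{n}=[n_1,\dots,n_k]\in\mathbb{Z}_{\ge0}^k$ and $r\ge 0$, let $s_k(r;\mathbf{n})$ be the number of sequences $(a_1,\dots,a_n)$, $n=\sum_j n_j$, with entries in $\{1,\dots,k\}$ in which each integer $j$ appears exactly $n_j$ times and which have exactly $r$ indices $t$ with $a_{t+1}-a_t=1$. Then, as formal power series in $x_1,\dots,x_k$ with coefficients polynomial in $w$, $$\sum_{\mathbf{n}\ne \mathbf{0}}\sum_{r\ge0} s_k(r;\mathbf{n})\,w^r x_1^{n_1}\cdots x_k^{n_k}=\frac{1}{1-\sum_{i=1}^k\sum_{l=0}^{i-1}(w-1)^l\prod_{j=i-l}^i x_j}-1 .$$
   Context: An index $t$ with $a_{t+1}-a_t=1$ is an increasing succession. The left-hand side is the generating function $\mathcal{G}_k$ of the paper obtained when each integer's generating function is $g_i=\sum_{j\ge1}x_i^j=x_i/(1-x_i)$. -}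

module Defs where

open import Data.Bool using (if_then_else_)
open import Data.Nat as ℕ using (ℕ; zero; suc; _∸_)
open import Data.Integer as ℤ using (ℤ; +_)
open import Data.Fin as Fin using (Fin; toℕ)
open import Data.Vec as Vec using (Vec; []; _∷_)
open import Data.Vec.Properties using (≡-dec)
open import Data.List as List using (List; upTo; concatMap; allFin; filter; length)
open import Data.Product using (_×_)
open import Relation.Nullary using (does)
open import Relation.Nullary.Decidable using (_×-dec_)
open import Relation.Binary.PropositionalEquality using (_≡_)

-- Formal power series over ℤ in m variables: coefficient functions on
-- exponent vectors. For the theorem m = suc k: position 0 is the
-- exponent of w, position j (1 ≤ j ≤ k) the exponent of x_j.

Series : ℕ → Set
Series m = Vec ℕ m → ℤ

sumTo : ℕ → (ℕ → ℤ) → ℤ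
sumTo zero    f = f 0
sumTo (suc n) f = sumTo n f ℤ.+ f (suc n)

sumBelow : ∀ {m} → Vec ℕ m → (Vec ℕ m → ℤ) → ℤ
sumBelow []      f = f []
sumBelow (x ∷ n) f = sumTo x (λ i → sumBelow n (λ v → f (i ∷ v)))

infixl 6 _⊕_ _⊖_
infixl 7 _⊛_

_⊕_ : ∀ {m} → Series m → Series m → Series m
(A ⊕ B) v = A v ℤ.+ B v

_⊖_ : ∀ {m} → Series m → Series m → Series m
(A ⊖ B) v = A v ℤ.- B v

_⊛_ : ∀ {m} → Series m → Series m → Series m
(A ⊛ B) n = sumBelow n (λ v → A v ℤ.* B (Vec.zipWith _∸_ n v))

mono : ∀ {m} → Vec ℕ m → Series m
mono e v = if does (≡-dec ℕ._≟_ v e) then + 1 else + 0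

zeroS : ∀ {m} → Series m
zeroS _ = + 0

oneS : ∀ {m} → Series m
oneS {m} = mono (Vec.replicate m 0)

powS : ∀ {m} → Series m → ℕ → Series m
powS A zero    = oneS
powS A (suc l) = A ⊛ powS A l

sumS : ∀ {m} → List (Series m) → Series m
sumS = List.foldr _⊕_ zeroS

prodS : ∀ {m} → List (Series m) → Series m
prodS = List.foldr _⊛_ oneS

W : (k : ℕ) → Series (suc k)
W k = mono (1 ∷ Vec.replicate k 0)

X : (k : ℕ) → ℕ → Series (suc k)
X k j = mono (0 ∷ Vec.tabulate (λ (p : Fin k) → if does (suc (toℕ p) ℕ.≟ j) then 1 else 0))

F : (k : ℕ) → Series (suc k)
F k = sumS (List.map (λ i' →
        sumS (List.map (λ l →
          powS (W k ⊖ oneS) l ⊛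
            prodS (List.map (λ t → X k ((suc i' ∸ l) ℕ.+ t)) (upTo (suc l))))
          (upTo (suc i'))))
        (upTo k))

-- Counting words. The letters 1..k are represented by Fin k (letter
-- j ↔ element j-1); the difference a_{t+1} - a_t is unchanged.

words : (k : ℕ) → ℕ → List (List (Fin k))
words k zero    = List.[ List.[] ]
words k (suc N) = concatMap (λ a → List.map (a List.∷_) (words k N)) (allFin k)

occ : ∀ {k} → Fin k → List (Fin k) → ℕ
occ j a = length (filter (j Fin.≟_) a)

mult : ∀ {k} → List (Fin k) → Vec ℕ k
mult a = Vec.tabulate (λ j → occ j a)

succs : ∀ {k} → List (Fin k) → ℕ
succs (a List.∷ b List.∷ t) =
  (if does (toℕ b ℕ.≟ suc (toℕ a)) then 1 else 0) ℕ.+ succs (b List.∷ t)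
succs _ = 0

s : (k : ℕ) → ℕ → Vec ℕ k → ℕ
s k r n = length (filter (λ a → (succs a ℕ.≟ r) ×-dec (≡-dec ℕ._≟_ (mult a) n))
                         (words k (Vec.sum n)))

G : (k : ℕ) → Series (suc k)
G k (r ∷ n) = if does (≡-dec ℕ._≟_ n (Vec.replicate k 0)) then + 0 else + s k r n

module Submission where

-- Let H = 1 + G_k and let V_a be the generating function of the words beginning with the
-- letter a.  Splitting off the first letter gives H = 1 + Σ_a V_a.  Removing the first letter
-- of a word beginning with a leaves the empty word or a word beginning with some b, and this
-- step is a succession exactly when b = a + 1; hence V_a = x_a (H + (w - 1) V_{a+1}), with
-- V_{k+1} = 0.  Unrolling, V_a = Σ_{m ≤ k-a} x_a ⋯ x_{a+m} (w - 1)^m H, and summing over a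
-- gives F_k H with the double sum of F_k reindexed.  So H = 1 + F_k H.

open import Algebra.Bundles using (CommutativeMonoid)
import Algebra.Properties.CommutativeSemigroup as CommutativeSemigroupₚ
open import Data.Bool using (Bool; true; false; if_then_else_; _∧_; T)
import Data.Bool.Properties as Boolₚ
open import Data.Fin as Fin using (Fin; toℕ)
import Data.Fin.Properties as Finₚ
open import Data.Integer using (ℤ; +_; _+_; _-_; -_; _*_)
import Data.Integer.Properties as ℤₚ
open import Data.Integer.Tactic.RingSolver using (solve-∀)
open import Data.List as List using (List; []; _∷_; _++_; applyUpTo; upTo; allFin; concatMap; filter)
import Data.List.Properties as Listₚ
open import Data.Nat as ℕ using (ℕ; zero; suc; _∸_; _≡ᵇ_; _≤ᵇ_; _<ᵇ_; _≤_)
import Data.Nat.Properties as ℕₚ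
open import Data.Vec as Vec using (Vec; []; _∷_)
import Data.Vec.Properties as Vecₚ
open Vecₚ using (≡-dec)
open import Function using (_∘_; id)
open import Relation.Binary.Definitions using (DecidableEquality; Tri; tri<; tri≈; tri>)
open import Relation.Binary.PropositionalEquality
open import Relation.Nullary using (does; yes; no; contradiction)
open import Relation.Nullary.Decidable using (dec-true; dec-false)
open import Relation.Unary using (Decidable)

open import Defs

open CommutativeSemigroupₚ ℕₚ.+-commutativeSemigroup using () renaming (interchange to ℕ-+-interchange)
open CommutativeSemigroupₚ ℤₚ.+-commutativeSemigroup using () renaming (interchange to +-interchange)
open CommutativeSemigroupₚ (CommutativeMonoid.commutativeSemigroup Boolₚ.∧-commutativeMonoid)
  using () renaming (interchange to ∧-interchange)

<ᵇ-suc : ∀ m n → (m <ᵇ suc n) ≡ (m ≤ᵇ n)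
<ᵇ-suc zero    n = refl
<ᵇ-suc (suc m) n = refl

≤⇒≤ᵇ≡true : ∀ {m n} → m ℕ.≤ n → (m ≤ᵇ n) ≡ true
≤⇒≤ᵇ≡true ℕ.z≤n                     = refl
≤⇒≤ᵇ≡true {suc m} {suc n} (ℕ.s≤s m≤n) = trans (<ᵇ-suc m n) (≤⇒≤ᵇ≡true m≤n)

>⇒≤ᵇ≡false : ∀ {m n} → n ℕ.< m → (m ≤ᵇ n) ≡ false
>⇒≤ᵇ≡false {suc m} {zero}  _           = refl
>⇒≤ᵇ≡false {suc m} {suc n} (ℕ.s≤s n<m) = trans (<ᵇ-suc m n) (>⇒≤ᵇ≡false n<m)

≤ᵇ≡true⇒≤ : ∀ m n → (m ≤ᵇ n) ≡ true → m ℕ.≤ n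
≤ᵇ≡true⇒≤ m n m≤n = ℕₚ.≤ᵇ⇒≤ m n (subst T (sym m≤n) _)

≤ᵇ-+ : ∀ a b x → ((a ≤ᵇ x) ∧ (b ≤ᵇ x ∸ a)) ≡ (a ℕ.+ b ≤ᵇ x)
≤ᵇ-+ zero    b x       = refl
≤ᵇ-+ (suc a) b zero    = refl
≤ᵇ-+ (suc a) b (suc x) =
  trans (cong (_∧ (b ≤ᵇ x ∸ a)) (<ᵇ-suc a x)) (trans (≤ᵇ-+ a b x) (sym (<ᵇ-suc (a ℕ.+ b) x)))

≡ᵇ-+ : ∀ a b x → (x ≡ᵇ a ℕ.+ b) ≡ ((a ≤ᵇ x) ∧ (x ∸ a ≡ᵇ b))
≡ᵇ-+ zero    b x       = refl
≡ᵇ-+ (suc a) b zero    = refl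
≡ᵇ-+ (suc a) b (suc x) = trans (≡ᵇ-+ a b x) (cong (_∧ (x ∸ a ≡ᵇ b)) (sym (<ᵇ-suc a x)))

does-sym : ∀ {a} {A : Set a} (_≟_ : DecidableEquality A) x y → does (x ≟ y) ≡ does (y ≟ x)
does-sym _≟_ x y with x ≟ y | y ≟ x
... | yes _   | yes _   = refl
... | no  _   | no  _   = refl
... | yes x≡y | no  y≢x = contradiction (sym x≡y) y≢x
... | no  x≢y | yes y≡x = contradiction (sym y≡x) x≢y

∑ : ℕ → (ℕ → ℤ) → ℤ
∑ zero    f = + 0
∑ (suc n) f = f 0 + ∑ n (f ∘ suc)

∑-congᵇ : ∀ n {f g : ℕ → ℤ} → (∀ i → i ℕ.< n → f i ≡ g i) → ∑ n f ≡ ∑ n g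
∑-congᵇ zero    eq = refl
∑-congᵇ (suc n) eq = cong₂ _+_ (eq 0 ℕ.z<s) (∑-congᵇ n (λ i i<n → eq (suc i) (ℕ.s<s i<n)))

∑-cong : ∀ n {f g : ℕ → ℤ} → f ≗ g → ∑ n f ≡ ∑ n g
∑-cong n eq = ∑-congᵇ n (λ i _ → eq i)

∑-zero : ∀ n → ∑ n (λ _ → + 0) ≡ + 0
∑-zero zero    = refl
∑-zero (suc n) = trans (ℤₚ.+-identityˡ _) (∑-zero n)

∑-+ : ∀ n (f g : ℕ → ℤ) → ∑ n (λ i → f i + g i) ≡ ∑ n f + ∑ n g
∑-+ zero    f g = refl
∑-+ (suc n) f g = begin
  f 0 + g 0 + ∑ n (λ i → f (suc i) + g (suc i))
    ≡⟨ cong (λ z → f 0 + g 0 + z) (∑-+ n (f ∘ suc) (g ∘ suc)) ⟩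
  f 0 + g 0 + (∑ n (f ∘ suc) + ∑ n (g ∘ suc))
    ≡⟨ +-interchange (f 0) (g 0) _ _ ⟩
  f 0 + ∑ n (f ∘ suc) + (g 0 + ∑ n (g ∘ suc))
    ∎
  where open ≡-Reasoning

∑-neg : ∀ n (f : ℕ → ℤ) → ∑ n (λ i → - f i) ≡ - ∑ n f
∑-neg zero    f = refl
∑-neg (suc n) f = trans (cong (λ z → - f 0 + z) (∑-neg n (f ∘ suc))) (sym (ℤₚ.neg-distrib-+ (f 0) _))

∑-sub : ∀ n (f g : ℕ → ℤ) → ∑ n (λ i → f i - g i) ≡ ∑ n f - ∑ n g
∑-sub n f g = trans (∑-+ n f (λ i → - g i)) (cong (λ z → ∑ n f + z) (∑-neg n g))

∑-suc : ∀ n (f : ℕ → ℤ) → ∑ (suc n) f ≡ ∑ n f + f n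
∑-suc zero    f = ℤₚ.+-comm (f 0) (+ 0)
∑-suc (suc n) f = trans (cong (λ z → f 0 + z) (∑-suc n (f ∘ suc))) (sym (ℤₚ.+-assoc (f 0) _ _))

sumTo≡∑ : ∀ x (f : ℕ → ℤ) → sumTo x f ≡ ∑ (suc x) f
sumTo≡∑ zero    f = sym (ℤₚ.+-identityʳ (f 0))
sumTo≡∑ (suc x) f = trans (cong (_+ f (suc x)) (sumTo≡∑ x f)) (sym (∑-suc (suc x) f))

∑-indicator : ∀ n j (φ : ℕ → ℤ) →
  ∑ n (λ i → if i ≡ᵇ j then φ i else + 0) ≡ (if j <ᵇ n then φ j else + 0)
∑-indicator zero    j       φ = refl
∑-indicator (suc n) zero    φ = trans (cong (λ z → φ 0 + z) (∑-zero n)) (ℤₚ.+-identityʳ (φ 0))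
∑-indicator (suc n) (suc j) φ = trans (ℤₚ.+-identityˡ _) (∑-indicator n j (φ ∘ suc))

∑-indicator-last : ∀ x (g : ℕ → ℤ) → ∑ (suc x) (λ i → if x ∸ i ≡ᵇ 0 then g i else + 0) ≡ g x
∑-indicator-last zero    g = ℤₚ.+-identityʳ (g 0)
∑-indicator-last (suc x) g = trans (ℤₚ.+-identityˡ _) (∑-indicator-last x (g ∘ suc))

∑-update : ∀ n j (h g : ℕ → ℤ) →
  ∑ n (λ i → if i ≡ᵇ j then h i else g i) ≡ ∑ n g + (if j <ᵇ n then h j - g j else + 0)
∑-update n j h g = begin
  ∑ n (λ i → if i ≡ᵇ j then h i else g i)
    ≡⟨ ∑-cong n (λ i → split (i ≡ᵇ j) (h i) (g i)) ⟩
  ∑ n (λ i → g i + (if i ≡ᵇ j then h i - g i else + 0))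
    ≡⟨ ∑-+ n g _ ⟩
  ∑ n g + ∑ n (λ i → if i ≡ᵇ j then h i - g i else + 0)
    ≡⟨ cong (λ z → ∑ n g + z) (∑-indicator n j (λ i → h i - g i)) ⟩
  ∑ n g + (if j <ᵇ n then h j - g j else + 0)
    ∎
  where
  open ≡-Reasoning
  +-minus : ∀ (a b : ℤ) → a ≡ b + (a - b)
  +-minus = solve-∀
  split : ∀ b (x y : ℤ) → (if b then x else y) ≡ y + (if b then x - y else + 0)
  split true  x y = +-minus x y
  split false x y = sym (ℤₚ.+-identityʳ y)

∑-triangle : ∀ k (f : ℕ → ℕ → ℤ) →
  ∑ k (λ i → ∑ (suc i) (λ l → f (suc i ∸ l) l)) ≡ ∑ k (λ j → ∑ (k ∸ j) (f (suc j)))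
∑-triangle zero    f = refl
∑-triangle (suc k) f = begin
  ∑ (suc k) (λ i → ∑ (suc i) (diagonal i))
    ≡⟨ ∑-cong (suc k) (λ i → trans (∑-suc i (diagonal i))
                                   (cong (λ j → ∑ i (diagonal i) + f j i) (ℕₚ.m+n∸n≡m 1 i))) ⟩
  ∑ (suc k) (λ i → ∑ i (diagonal i) + f 1 i)
    ≡⟨ ∑-+ (suc k) (λ i → ∑ i (diagonal i)) (f 1) ⟩
  + 0 + ∑ k (λ i → ∑ (suc i) (diagonal (suc i))) + ∑ (suc k) (f 1)
    ≡⟨ cong (_+ ∑ (suc k) (f 1)) (trans (ℤₚ.+-identityˡ _) (∑-cong k (λ i →
         ∑-congᵇ (suc i) (λ l l<1+i → cong (λ j → f j l) (ℕₚ.+-∸-assoc 1 (ℕₚ.<⇒≤ l<1+i)))))) ⟩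
  ∑ k (λ i → ∑ (suc i) (λ l → f (suc (suc i ∸ l)) l)) + ∑ (suc k) (f 1)
    ≡⟨ cong (_+ ∑ (suc k) (f 1)) (∑-triangle k (f ∘ suc)) ⟩
  ∑ k (λ j → ∑ (k ∸ j) (f (suc (suc j)))) + ∑ (suc k) (f 1)
    ≡⟨ ℤₚ.+-comm _ (∑ (suc k) (f 1)) ⟩
  ∑ (suc k) (λ j → ∑ (suc k ∸ j) (f (suc j)))
    ∎
  where
  open ≡-Reasoning
  -- The terms l = i on the left are the row j = 0 on the right.
  diagonal : ℕ → ℕ → ℤ
  diagonal i l = f (suc i ∸ l) l

-- The one-variable case of  A ⊛ (x^e · B) = x^e · (A ⊛ B).
∑-truncate : ∀ x e (h : ℕ → ℕ → ℤ) →
  ∑ (suc x) (λ i → if e ≤ᵇ x ∸ i then h i (x ∸ i ∸ e) else + 0) ≡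
  (if e ≤ᵇ x then ∑ (suc (x ∸ e)) (λ i → h i (x ∸ e ∸ i)) else + 0)
∑-truncate zero    zero    h = refl
∑-truncate zero    (suc e) h = refl
∑-truncate (suc x) e       h =
  trans (cong (λ z → (if e ≤ᵇ suc x then h 0 (suc x ∸ e) else + 0) + z) (∑-truncate x e (h ∘ suc)))
        (by-cases (ℕₚ.<-cmp e (suc x)))
  where
  by-cases : Tri (e ℕ.< suc x) (e ≡ suc x) (suc x ℕ.< e) →
    (if e ≤ᵇ suc x then h 0 (suc x ∸ e) else + 0) +
    (if e ≤ᵇ x then ∑ (suc (x ∸ e)) (λ i → h (suc i) (x ∸ e ∸ i)) else + 0)
    ≡ (if e ≤ᵇ suc x then ∑ (suc (suc x ∸ e)) (λ i → h i (suc x ∸ e ∸ i)) else + 0)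
  by-cases (tri< (ℕ.s≤s e≤x) _ _)
    rewrite ≤⇒≤ᵇ≡true (ℕₚ.m≤n⇒m≤1+n e≤x) | ≤⇒≤ᵇ≡true e≤x | ℕₚ.+-∸-assoc 1 e≤x = refl
  by-cases (tri≈ _ refl _)
    rewrite ≤⇒≤ᵇ≡true (ℕₚ.≤-refl {suc x}) | >⇒≤ᵇ≡false (ℕₚ.n<1+n x) | ℕₚ.n∸n≡0 x = refl
  by-cases (tri> _ _ 1+x<e)
    rewrite >⇒≤ᵇ≡false 1+x<e | >⇒≤ᵇ≡false (ℕₚ.<-trans (ℕₚ.n<1+n x) 1+x<e) = refl

-- Exponent vectors

private variable m : ℕ

infix  4 _≤ᵇ*_ _≡ᵇ*_
infixl 6 _+*_ _∸*_

_≤ᵇ*_ : Vec ℕ m → Vec ℕ m → Bool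
[]       ≤ᵇ* []       = true
(x ∷ xs) ≤ᵇ* (y ∷ ys) = (x ≤ᵇ y) ∧ (xs ≤ᵇ* ys)

-- Stated through ≡-dec so that mono e v unfolds to if v ≡ᵇ* e then + 1 else + 0.
_≡ᵇ*_ : Vec ℕ m → Vec ℕ m → Bool
u ≡ᵇ* v = does (≡-dec ℕ._≟_ u v)

_+*_ : Vec ℕ m → Vec ℕ m → Vec ℕ m
_+*_ = Vec.zipWith ℕ._+_

_∸*_ : Vec ℕ m → Vec ℕ m → Vec ℕ m
_∸*_ = Vec.zipWith _∸_

0* : Vec ℕ m
0* {m} = Vec.replicate m 0

≤ᵇ*-+* : ∀ (e f v : Vec ℕ m) → ((e ≤ᵇ* v) ∧ (f ≤ᵇ* v ∸* e)) ≡ (e +* f ≤ᵇ* v)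
≤ᵇ*-+* []       []       []       = refl
≤ᵇ*-+* (a ∷ e) (b ∷ f) (x ∷ v) =
  trans (∧-interchange (a ≤ᵇ x) (e ≤ᵇ* v) (b ≤ᵇ x ∸ a) (f ≤ᵇ* v ∸* e))
        (cong₂ _∧_ (≤ᵇ-+ a b x) (≤ᵇ*-+* e f v))

≡ᵇ*-+* : ∀ (e f v : Vec ℕ m) → (v ≡ᵇ* e +* f) ≡ ((e ≤ᵇ* v) ∧ (v ∸* e ≡ᵇ* f))
≡ᵇ*-+* []       []       []       = refl
≡ᵇ*-+* (a ∷ e) (b ∷ f) (x ∷ v) =
  trans (cong₂ _∧_ (≡ᵇ-+ a b x) (≡ᵇ*-+* e f v))
        (∧-interchange (a ≤ᵇ x) (x ∸ a ≡ᵇ b) (e ≤ᵇ* v) (v ∸* e ≡ᵇ* f))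

∸*-+* : ∀ (v e f : Vec ℕ m) → v ∸* e ∸* f ≡ v ∸* (e +* f)
∸*-+* []      []      []      = refl
∸*-+* (x ∷ v) (a ∷ e) (b ∷ f) = cong₂ _∷_ (ℕₚ.∸-+-assoc x a b) (∸*-+* v e f)

+*-comm : ∀ (e f : Vec ℕ m) → e +* f ≡ f +* e
+*-comm = Vecₚ.zipWith-comm ℕₚ.+-comm

+*-identityˡ : ∀ (e : Vec ℕ m) → 0* +* e ≡ e
+*-identityˡ = Vecₚ.zipWith-identityˡ ℕₚ.+-identityˡ

∸*-identityʳ : ∀ (v : Vec ℕ m) → v ∸* 0* ≡ v
∸*-identityʳ = Vecₚ.zipWith-identityʳ (λ _ → refl)

0*-≤ᵇ* : ∀ (v : Vec ℕ m) → (0* ≤ᵇ* v) ≡ true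
0*-≤ᵇ* []      = refl
0*-≤ᵇ* (x ∷ v) = 0*-≤ᵇ* v

+*-tabulate : ∀ (f g : Fin m → ℕ) → Vec.tabulate f +* Vec.tabulate g ≡ Vec.tabulate (λ p → f p ℕ.+ g p)
+*-tabulate {zero}  f g = refl
+*-tabulate {suc m} f g = cong (f Fin.zero ℕ.+ g Fin.zero ∷_) (+*-tabulate (f ∘ Fin.suc) (g ∘ Fin.suc))

tabulate-0 : ∀ n → Vec.tabulate {n = n} (λ _ → 0) ≡ 0*
tabulate-0 zero    = refl
tabulate-0 (suc n) = cong (0 ∷_) (tabulate-0 n)

sum-0* : ∀ m → Vec.sum (0* {m}) ≡ 0
sum-0* zero    = refl
sum-0* (suc m) = sum-0* m

sum≡0⇒0* : ∀ (v : Vec ℕ m) → Vec.sum v ≡ 0 → v ≡ 0*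
sum≡0⇒0* []         _   = refl
sum≡0⇒0* (zero ∷ v) Σ≡0 = cong (0 ∷_) (sum≡0⇒0* v Σ≡0)

sum-∸*-+ : ∀ (e v : Vec ℕ m) → (e ≤ᵇ* v) ≡ true →
  Vec.sum (v ∸* e) ℕ.+ Vec.sum e ≡ Vec.sum v
sum-∸*-+ []      []      _   = refl
sum-∸*-+ (a ∷ e) (x ∷ v) _ with a ≤ᵇ x in a≤x | e ≤ᵇ* v in e≤v
... | true | true = begin
  (x ∸ a) ℕ.+ Vec.sum (v ∸* e) ℕ.+ (a ℕ.+ Vec.sum e)
    ≡⟨ ℕ-+-interchange (x ∸ a) _ a _ ⟩
  (x ∸ a) ℕ.+ a ℕ.+ (Vec.sum (v ∸* e) ℕ.+ Vec.sum e)
    ≡⟨ cong₂ ℕ._+_ (ℕₚ.m∸n+n≡m (≤ᵇ≡true⇒≤ a x a≤x)) (sum-∸*-+ e v e≤v) ⟩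
  x ℕ.+ Vec.sum v
    ∎
  where open ≡-Reasoning

sum-indicatorVec : ∀ n j →
  Vec.sum (Vec.tabulate {n = n} (λ p → if toℕ p ≡ᵇ j then 1 else 0)) ≡ (if j <ᵇ n then 1 else 0)
sum-indicatorVec zero    j       = refl
sum-indicatorVec (suc n) (suc j) = sum-indicatorVec n j
sum-indicatorVec (suc n) zero    = cong suc (trans (cong Vec.sum (tabulate-0 n)) (sum-0* n))

-- Multiplication by monomials

-- x^e · A
shift : Vec ℕ m → Series m → Series m
shift e A v = if e ≤ᵇ* v then A (v ∸* e) else + 0

shift-cong : ∀ (e : Vec ℕ m) {A B : Series m} → A ≗ B → shift e A ≗ shift e B
shift-cong e A≗B v with e ≤ᵇ* v
... | true  = A≗B (v ∸* e)
... | false = refl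

shift-+* : ∀ (e f : Vec ℕ m) (A : Series m) → shift (e +* f) A ≗ shift e (shift f A)
shift-+* e f A v = begin
  (if e +* f ≤ᵇ* v then A (v ∸* (e +* f)) else + 0)
    ≡⟨ cong₂ (λ b u → if b then A u else + 0) (sym (≤ᵇ*-+* e f v)) (sym (∸*-+* v e f)) ⟩
  (if (e ≤ᵇ* v) ∧ (f ≤ᵇ* v ∸* e) then A (v ∸* e ∸* f) else + 0)
    ≡⟨ Boolₚ.if-∧ (e ≤ᵇ* v) ⟩
  shift e (shift f A) v
    ∎
  where open ≡-Reasoning

shift-comm : ∀ (e f : Vec ℕ m) (A : Series m) → shift e (shift f A) ≗ shift f (shift e A)
shift-comm e f A v = begin
  shift e (shift f A) v ≡⟨ shift-+* e f A v ⟨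
  shift (e +* f) A v    ≡⟨ cong (λ g → shift g A v) (+*-comm e f) ⟩
  shift (f +* e) A v    ≡⟨ shift-+* f e A v ⟩
  shift f (shift e A) v ∎
  where open ≡-Reasoning

shift-0* : ∀ (A : Series m) → shift 0* A ≗ A
shift-0* A v rewrite 0*-≤ᵇ* v = cong A (∸*-identityʳ v)

shift-zeroS : ∀ (e : Vec ℕ m) → shift e zeroS ≗ zeroS
shift-zeroS e v = Boolₚ.if-eta (e ≤ᵇ* v)

shift-⊕ : ∀ (e : Vec ℕ m) (A B : Series m) → shift e (A ⊕ B) ≗ shift e A ⊕ shift e B
shift-⊕ e A B v with e ≤ᵇ* v
... | true  = refl
... | false = refl

shift-⊖ : ∀ (e : Vec ℕ m) (A B : Series m) → shift e (A ⊖ B) ≗ shift e A ⊖ shift e B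
shift-⊖ e A B v with e ≤ᵇ* v
... | true  = refl
... | false = refl

∑ˢ : ℕ → (ℕ → Series m) → Series m
∑ˢ n Φ v = ∑ n (λ i → Φ i v)

shift-∑ˢ : ∀ (e : Vec ℕ m) n (Φ : ℕ → Series m) → shift e (∑ˢ n Φ) ≗ ∑ˢ n (λ i → shift e (Φ i))
shift-∑ˢ e n Φ v with e ≤ᵇ* v
... | true  = refl
... | false = sym (∑-zero n)

-- Cauchy products

sumTo-cong : ∀ x {f g : ℕ → ℤ} → f ≗ g → sumTo x f ≡ sumTo x g
sumTo-cong zero    f≗g = f≗g 0
sumTo-cong (suc x) f≗g = cong₂ _+_ (sumTo-cong x f≗g) (f≗g (suc x))

sumBelow-cong : ∀ (n : Vec ℕ m) {f g : Vec ℕ m → ℤ} → f ≗ g → sumBelow n f ≡ sumBelow n g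
sumBelow-cong []      f≗g = f≗g []
sumBelow-cong (x ∷ n) f≗g = sumTo-cong x (λ i → sumBelow-cong n (λ u → f≗g (i ∷ u)))

sumBelow-zero : ∀ (n : Vec ℕ m) → sumBelow n (λ _ → + 0) ≡ + 0
sumBelow-zero []      = refl
sumBelow-zero (x ∷ n) = begin
  sumTo x (λ _ → sumBelow n (λ _ → + 0)) ≡⟨ sumTo-cong x (λ _ → sumBelow-zero n) ⟩
  sumTo x (λ _ → + 0)                    ≡⟨ sumTo≡∑ x _ ⟩
  ∑ (suc x) (λ _ → + 0)                  ≡⟨ ∑-zero (suc x) ⟩
  + 0                                    ∎
  where open ≡-Reasoning

sumBelow-+ : ∀ (n : Vec ℕ m) (f g : Vec ℕ m → ℤ) →
  sumBelow n (λ u → f u + g u) ≡ sumBelow n f + sumBelow n g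
sumBelow-+ []      f g = refl
sumBelow-+ (x ∷ n) f g = begin
  sumTo x (λ i → sumBelow n (λ u → f (i ∷ u) + g (i ∷ u)))
    ≡⟨ sumTo-cong x (λ i → sumBelow-+ n _ _) ⟩
  sumTo x (λ i → φ i + ψ i)
    ≡⟨ sumTo≡∑ x _ ⟩
  ∑ (suc x) (λ i → φ i + ψ i)
    ≡⟨ ∑-+ (suc x) φ ψ ⟩
  ∑ (suc x) φ + ∑ (suc x) ψ
    ≡⟨ cong₂ _+_ (sumTo≡∑ x φ) (sumTo≡∑ x ψ) ⟨
  sumTo x φ + sumTo x ψ
    ∎
  where
  open ≡-Reasoning
  φ ψ : ℕ → ℤ
  φ i = sumBelow n (λ u → f (i ∷ u))
  ψ i = sumBelow n (λ u → g (i ∷ u))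

sumBelow-neg : ∀ (n : Vec ℕ m) (f : Vec ℕ m → ℤ) → sumBelow n (λ u → - f u) ≡ - sumBelow n f
sumBelow-neg []      f = refl
sumBelow-neg (x ∷ n) f = begin
  sumTo x (λ i → sumBelow n (λ u → - f (i ∷ u))) ≡⟨ sumTo-cong x (λ i → sumBelow-neg n _) ⟩
  sumTo x (λ i → - φ i)                          ≡⟨ sumTo≡∑ x _ ⟩
  ∑ (suc x) (λ i → - φ i)                        ≡⟨ ∑-neg (suc x) φ ⟩
  - ∑ (suc x) φ                                  ≡⟨ cong -_ (sumTo≡∑ x φ) ⟨
  - sumTo x φ                                    ∎
  where
  open ≡-Reasoning
  φ : ℕ → ℤ
  φ i = sumBelow n (λ u → f (i ∷ u))

sumBelow-sub : ∀ (n : Vec ℕ m) (f g : Vec ℕ m → ℤ) →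
  sumBelow n (λ u → f u - g u) ≡ sumBelow n f - sumBelow n g
sumBelow-sub n f g =
  trans (sumBelow-+ n f (λ u → - g u)) (cong (λ z → sumBelow n f + z) (sumBelow-neg n g))

sumBelow-if : ∀ (n : Vec ℕ m) b (f : Vec ℕ m → ℤ) →
  sumBelow n (λ u → if b then f u else + 0) ≡ (if b then sumBelow n f else + 0)
sumBelow-if n true  f = refl
sumBelow-if n false f = sumBelow-zero n

oneS-∷ : ∀ r (n : Vec ℕ m) → n ≢ 0* → oneS (r ∷ n) ≡ + 0
oneS-∷ r n n≢0 =
  Boolₚ.if-cong (trans (cong (does (r ℕ.≟ 0) ∧_) (dec-false (≡-dec ℕ._≟_ n 0*) n≢0)) (Boolₚ.∧-zeroʳ _))

⊛-congʳ : ∀ (A : Series m) {B C : Series m} → B ≗ C → A ⊛ B ≗ A ⊛ C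
⊛-congʳ A B≗C n = sumBelow-cong n (λ u → cong (A u *_) (B≗C _))

⊛-distribˡ-⊕ : ∀ (A B C : Series m) → A ⊛ (B ⊕ C) ≗ A ⊛ B ⊕ A ⊛ C
⊛-distribˡ-⊕ A B C n = trans (sumBelow-cong n (λ u → ℤₚ.*-distribˡ-+ (A u) _ _)) (sumBelow-+ n _ _)

⊛-distribˡ-⊖ : ∀ (A B C : Series m) → A ⊛ (B ⊖ C) ≗ A ⊛ B ⊖ A ⊛ C
⊛-distribˡ-⊖ A B C n = trans (sumBelow-cong n (λ u → *-distribˡ-sub (A u) _ _)) (sumBelow-sub n _ _)
  where
  *-distribˡ-sub : ∀ (a b c : ℤ) → a * (b - c) ≡ a * b - a * c
  *-distribˡ-sub = solve-∀

⊛-distribʳ-⊖ : ∀ (A B C : Series m) → (A ⊖ B) ⊛ C ≗ A ⊛ C ⊖ B ⊛ C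
⊛-distribʳ-⊖ A B C n = trans (sumBelow-cong n (λ u → *-distribʳ-sub (A u) (B u) _)) (sumBelow-sub n _ _)
  where
  *-distribʳ-sub : ∀ (a b c : ℤ) → (a - b) * c ≡ a * c - b * c
  *-distribʳ-sub = solve-∀

⊛-zeroʳ : ∀ (A : Series m) → A ⊛ zeroS ≗ zeroS
⊛-zeroʳ A n = trans (sumBelow-cong n (λ u → ℤₚ.*-zeroʳ (A u))) (sumBelow-zero n)

⊛-∑ˢ : ∀ (A : Series m) n (Φ : ℕ → Series m) → A ⊛ ∑ˢ n Φ ≗ ∑ˢ n (λ i → A ⊛ Φ i)
⊛-∑ˢ A zero    Φ v = ⊛-zeroʳ A v
⊛-∑ˢ A (suc n) Φ v =
  trans (⊛-distribˡ-⊕ A (Φ 0) (∑ˢ n (Φ ∘ suc)) v)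
        (cong (λ z → (A ⊛ Φ 0) v + z) (⊛-∑ˢ A n (Φ ∘ suc) v))

mono-⊛ : ∀ (e : Vec ℕ m) (A : Series m) → mono e ⊛ A ≗ shift e A
mono-⊛ []       A []      = ℤₚ.*-identityˡ (A [])
mono-⊛ (a ∷ e) A (x ∷ n) = begin
  sumTo x (λ i → sumBelow n (λ u → mono (a ∷ e) (i ∷ u) * A ((x ∸ i) ∷ (n ∸* u))))
    ≡⟨ sumTo-cong x (λ i → sumBelow-cong n (λ u → first-exponent i u)) ⟩
  sumTo x (λ i → sumBelow n (λ u → if i ≡ᵇ a then mono e u * Aᵢ i (n ∸* u) else + 0))
    ≡⟨ sumTo-cong x (λ i → sumBelow-if n (i ≡ᵇ a) _) ⟩
  sumTo x (λ i → if i ≡ᵇ a then (mono e ⊛ Aᵢ i) n else + 0)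
    ≡⟨ sumTo≡∑ x _ ⟩
  ∑ (suc x) (λ i → if i ≡ᵇ a then (mono e ⊛ Aᵢ i) n else + 0)
    ≡⟨ ∑-indicator (suc x) a (λ i → (mono e ⊛ Aᵢ i) n) ⟩
  (if a <ᵇ suc x then (mono e ⊛ Aᵢ a) n else + 0)
    ≡⟨ Boolₚ.if-cong-then (a <ᵇ suc x) (mono-⊛ e (Aᵢ a) n) ⟩
  (if a <ᵇ suc x then shift e (Aᵢ a) n else + 0)
    ≡⟨ Boolₚ.if-cong (<ᵇ-suc a x) ⟩
  (if a ≤ᵇ x then shift e (Aᵢ a) n else + 0)
    ≡⟨ Boolₚ.if-∧ (a ≤ᵇ x) ⟨
  shift (a ∷ e) A (x ∷ n)
    ∎
  where
  open ≡-Reasoning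
  Aᵢ : ℕ → Series _
  Aᵢ i u = A ((x ∸ i) ∷ u)
  first-exponent : ∀ i u → mono (a ∷ e) (i ∷ u) * A ((x ∸ i) ∷ (n ∸* u))
                         ≡ (if i ≡ᵇ a then mono e u * Aᵢ i (n ∸* u) else + 0)
  first-exponent i u with i ≡ᵇ a
  ... | true  = refl
  ... | false = ℤₚ.*-zeroˡ (A ((x ∸ i) ∷ (n ∸* u)))

mono-+* : ∀ (e f : Vec ℕ m) → mono (e +* f) ≗ shift e (mono f)
mono-+* e f v = trans (Boolₚ.if-cong (≡ᵇ*-+* e f v)) (Boolₚ.if-∧ (e ≤ᵇ* v))

⊛-identityʳ : ∀ (A : Series m) → A ⊛ oneS ≗ A
⊛-identityʳ A []      = ℤₚ.*-identityʳ (A [])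
⊛-identityʳ A (x ∷ n) = begin
  sumTo x (λ i → sumBelow n (λ u → A (i ∷ u) * oneS ((x ∸ i) ∷ (n ∸* u))))
    ≡⟨ sumTo-cong x (λ i → sumBelow-cong n (λ u → first-exponent i u)) ⟩
  sumTo x (λ i → sumBelow n (λ u → if x ∸ i ≡ᵇ 0 then Aᵢ i u * oneS (n ∸* u) else + 0))
    ≡⟨ sumTo-cong x (λ i → trans (sumBelow-if n (x ∸ i ≡ᵇ 0) _)
                                 (Boolₚ.if-cong-then (x ∸ i ≡ᵇ 0) (⊛-identityʳ (Aᵢ i) n))) ⟩
  sumTo x (λ i → if x ∸ i ≡ᵇ 0 then A (i ∷ n) else + 0)
    ≡⟨ sumTo≡∑ x _ ⟩
  ∑ (suc x) (λ i → if x ∸ i ≡ᵇ 0 then A (i ∷ n) else + 0)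
    ≡⟨ ∑-indicator-last x (λ i → A (i ∷ n)) ⟩
  A (x ∷ n)
    ∎
  where
  open ≡-Reasoning
  Aᵢ : ℕ → Series _
  Aᵢ i u = A (i ∷ u)
  first-exponent : ∀ i u → A (i ∷ u) * oneS ((x ∸ i) ∷ (n ∸* u))
                         ≡ (if x ∸ i ≡ᵇ 0 then Aᵢ i u * oneS (n ∸* u) else + 0)
  first-exponent i u with x ∸ i ≡ᵇ 0
  ... | true  = refl
  ... | false = ℤₚ.*-zeroʳ (A (i ∷ u))

⊛-shift : ∀ (e : Vec ℕ m) (A B : Series m) → A ⊛ shift e B ≗ shift e (A ⊛ B)
⊛-shift []       A B []      = refl
⊛-shift (a ∷ e) A B (x ∷ n) = begin
  sumTo x (λ i → sumBelow n (λ u → A (i ∷ u) * shift (a ∷ e) B ((x ∸ i) ∷ (n ∸* u))))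
    ≡⟨ sumTo-cong x (λ i → sumBelow-cong n (λ u → first-exponent i u)) ⟩
  sumTo x (λ i → sumBelow n (λ u → if a ≤ᵇ x ∸ i then Aᵢ i u * shift e (Bᵢ i) (n ∸* u) else + 0))
    ≡⟨ sumTo-cong x (λ i → trans (sumBelow-if n (a ≤ᵇ x ∸ i) _)
                                 (Boolₚ.if-cong-then (a ≤ᵇ x ∸ i) (⊛-shift e (Aᵢ i) (Bᵢ i) n))) ⟩
  sumTo x (λ i → if a ≤ᵇ x ∸ i then shift e (Aᵢ i ⊛ Bᵢ i) n else + 0)
    ≡⟨ sumTo≡∑ x _ ⟩
  ∑ (suc x) (λ i → if a ≤ᵇ x ∸ i then shift e (Aᵢ i ⊛ Bᵢ i) n else + 0)
    ≡⟨ truncate ⟩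
  shift (a ∷ e) (A ⊛ B) (x ∷ n)
    ∎
  where
  open ≡-Reasoning
  Aᵢ Bᵢ : ℕ → Series _
  Aᵢ i u = A (i ∷ u)
  Bᵢ i u = B ((x ∸ i ∸ a) ∷ u)
  first-exponent : ∀ i u → A (i ∷ u) * shift (a ∷ e) B ((x ∸ i) ∷ (n ∸* u))
                         ≡ (if a ≤ᵇ x ∸ i then Aᵢ i u * shift e (Bᵢ i) (n ∸* u) else + 0)
  first-exponent i u with a ≤ᵇ x ∸ i
  ... | true  = refl
  ... | false = ℤₚ.*-zeroʳ (A (i ∷ u))
  truncate : ∑ (suc x) (λ i → if a ≤ᵇ x ∸ i then shift e (Aᵢ i ⊛ Bᵢ i) n else + 0)
           ≡ shift (a ∷ e) (A ⊛ B) (x ∷ n)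
  truncate with e ≤ᵇ* n
  ... | true  = begin
    ∑ (suc x) (λ i → if a ≤ᵇ x ∸ i then (Aᵢ i ⊛ Bᵢ i) (n ∸* e) else + 0)
      ≡⟨ ∑-truncate x a (λ i y → (Aᵢ i ⊛ (λ u → B (y ∷ u))) (n ∸* e)) ⟩
    (if a ≤ᵇ x then ∑ (suc (x ∸ a)) (λ i → (Aᵢ i ⊛ (λ u → B ((x ∸ a ∸ i) ∷ u))) (n ∸* e)) else + 0)
      ≡⟨ Boolₚ.if-cong-then (a ≤ᵇ x) (sym (sumTo≡∑ (x ∸ a) _)) ⟩
    (if a ≤ᵇ x then (A ⊛ B) ((x ∸ a) ∷ (n ∸* e)) else + 0)
      ≡⟨ Boolₚ.if-cong (Boolₚ.∧-identityʳ (a ≤ᵇ x)) ⟨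
    (if (a ≤ᵇ x) ∧ true then (A ⊛ B) ((x ∸ a) ∷ (n ∸* e)) else + 0)
      ∎
  ... | false = begin
    ∑ (suc x) (λ i → if a ≤ᵇ x ∸ i then + 0 else + 0)
      ≡⟨ ∑-cong (suc x) {g = λ _ → + 0} (λ i → Boolₚ.if-eta (a ≤ᵇ x ∸ i)) ⟩
    ∑ (suc x) (λ _ → + 0)
      ≡⟨ ∑-zero (suc x) ⟩
    + 0
      ≡⟨ Boolₚ.if-cong (Boolₚ.∧-zeroʳ (a ≤ᵇ x)) ⟨
    (if (a ≤ᵇ x) ∧ false then (A ⊛ B) ((x ∸ a) ∷ (n ∸* e)) else + 0)
      ∎

sumS-++ : ∀ (As Bs : List (Series m)) → sumS (As ++ Bs) ≗ sumS As ⊕ sumS Bs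
sumS-++ []       Bs v = sym (ℤₚ.+-identityˡ _)
sumS-++ (A ∷ As) Bs v = trans (cong (λ z → A v + z) (sumS-++ As Bs v)) (sym (ℤₚ.+-assoc (A v) _ _))

sumS-map-cong : ∀ {a} {I : Set a} {φ ψ : I → Series m} → (∀ x → φ x ≗ ψ x) →
  ∀ xs → sumS (List.map φ xs) ≗ sumS (List.map ψ xs)
sumS-map-cong φ≗ψ []       v = refl
sumS-map-cong φ≗ψ (x ∷ xs) v = cong₂ _+_ (φ≗ψ x v) (sumS-map-cong φ≗ψ xs v)

sumS-map-concatMap : ∀ {a b} {I : Set a} {J : Set b} (φ : J → Series m) (h : I → List J) xs →
  sumS (List.map φ (concatMap h xs)) ≗ sumS (List.map (λ x → sumS (List.map φ (h x))) xs)
sumS-map-concatMap φ h []       v = refl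
sumS-map-concatMap φ h (x ∷ xs) v = begin
  sumS (List.map φ (h x ++ concatMap h xs)) v
    ≡⟨ cong (λ As → sumS As v) (Listₚ.map-++ φ (h x) (concatMap h xs)) ⟩
  sumS (List.map φ (h x) ++ List.map φ (concatMap h xs)) v
    ≡⟨ sumS-++ (List.map φ (h x)) _ v ⟩
  sumS (List.map φ (h x)) v + sumS (List.map φ (concatMap h xs)) v
    ≡⟨ cong (λ z → sumS (List.map φ (h x)) v + z) (sumS-map-concatMap φ h xs v) ⟩
  sumS (List.map (λ x → sumS (List.map φ (h x))) (x ∷ xs)) v
    ∎
  where open ≡-Reasoning

sumS-map-shift : ∀ {a} {I : Set a} (e : Vec ℕ m) {φ ψ : I → Series m} →
  (∀ x → φ x ≗ shift e (ψ x)) → ∀ xs → sumS (List.map φ xs) ≗ shift e (sumS (List.map ψ xs))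
sumS-map-shift e φ≗ []       v = sym (shift-zeroS e v)
sumS-map-shift e {ψ = ψ} φ≗ (x ∷ xs) v =
  trans (cong₂ _+_ (φ≗ x v) (sumS-map-shift e {ψ = ψ} φ≗ xs v))
        (sym (shift-⊕ e (ψ x) (sumS (List.map ψ xs)) v))

applyUpTo-cong : ∀ {a} {I : Set a} {f g : ℕ → I} → f ≗ g → ∀ n → applyUpTo f n ≡ applyUpTo g n
applyUpTo-cong f≗g zero    = refl
applyUpTo-cong f≗g (suc n) = cong₂ _∷_ (f≗g 0) (applyUpTo-cong (f≗g ∘ suc) n)

sumS-map-applyUpTo : ∀ (g : ℕ → Series m) (f : ℕ → ℕ) N →
  sumS (List.map g (applyUpTo f N)) ≗ ∑ˢ N (g ∘ f)
sumS-map-applyUpTo g f zero    v = refl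
sumS-map-applyUpTo g f (suc N) v = cong (λ z → g (f 0) v + z) (sumS-map-applyUpTo g (f ∘ suc) N v)

sumS-map-allFin : ∀ n (g : ℕ → Series m) → sumS (List.map (g ∘ toℕ) (allFin n)) ≗ ∑ˢ n g
sumS-map-allFin n g v =
  trans (cong (λ As → sumS As v) (Listₚ.map-tabulate {n = n} id (g ∘ toℕ))) (tabulate-toℕ n g)
  where
  tabulate-toℕ : ∀ n (g : ℕ → Series _) → sumS (List.tabulate {n = n} (g ∘ toℕ)) v ≡ ∑ˢ n g v
  tabulate-toℕ zero    g = refl
  tabulate-toℕ (suc n) g = cong (λ z → g 0 v + z) (tabulate-toℕ n (g ∘ suc))

length-filter≡sumS : ∀ {a p} {I : Set a} {P : I → Set p} (P? : Decidable P) (φ : I → Series m) v →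
  (∀ x → φ x v ≡ (if does (P? x) then + 1 else + 0)) →
  ∀ xs → + List.length (filter P? xs) ≡ sumS (List.map φ xs) v
length-filter≡sumS P? φ v φ≡𝟙 []       = refl
length-filter≡sumS P? φ v φ≡𝟙 (x ∷ xs) with does (P? x) | φ≡𝟙 x
... | true  | φxv≡1 = trans (ℤₚ.pos-+ 1 _) (cong₂ _+_ (sym φxv≡1) (length-filter≡sumS P? φ v φ≡𝟙 xs))
... | false | φxv≡0 = begin
  + List.length (filter P? xs)    ≡⟨ length-filter≡sumS P? φ v φ≡𝟙 xs ⟩
  sumS (List.map φ xs) v          ≡⟨ ℤₚ.+-identityˡ _ ⟨
  + 0 + sumS (List.map φ xs) v    ≡⟨ cong (_+ sumS (List.map φ xs) v) φxv≡0 ⟨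
  φ x v + sumS (List.map φ xs) v  ∎
  where open ≡-Reasoning

-- The generating functions

module _ (k : ℕ) where

  unitExp : ℕ → Vec ℕ k
  unitExp j = Vec.tabulate (λ (p : Fin k) → if does (suc (toℕ p) ℕ.≟ j) then 1 else 0)

  xExp : ℕ → Vec ℕ (suc k)
  xExp j = 0 ∷ unitExp j

  wExp : Vec ℕ (suc k)
  wExp = 1 ∷ 0*

  -- (w - 1) · A
  Δ : Series (suc k) → Series (suc k)
  Δ A = shift wExp A ⊖ A

  run : ℕ → ℕ → Vec ℕ (suc k)
  run j zero    = xExp j
  run j (suc m) = xExp j +* run (suc j) m

  H : Series (suc k)
  H = oneS ⊕ G k

  D : ℕ → Series (suc k)
  D l = H ⊛ powS (W k ⊖ oneS) l

  D-suc : ∀ l → D (suc l) ≗ Δ (D l)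
  D-suc l v = begin
    (H ⊛ ((W k ⊖ oneS) ⊛ P)) v    ≡⟨ ⊛-congʳ H w-1 v ⟩
    (H ⊛ Δ P) v                   ≡⟨ ⊛-distribˡ-⊖ H (shift wExp P) P v ⟩
    (H ⊛ shift wExp P) v - D l v  ≡⟨ cong (_- D l v) (⊛-shift wExp H P v) ⟩
    shift wExp (D l) v - D l v    ∎
    where
    open ≡-Reasoning
    P = powS (W k ⊖ oneS) l
    w-1 : (W k ⊖ oneS) ⊛ P ≗ Δ P
    w-1 u = trans (⊛-distribʳ-⊖ (W k) oneS P u)
                  (cong₂ _-_ (mono-⊛ wExp P u) (trans (mono-⊛ 0* P u) (shift-0* P u)))

  prodS-run : ∀ c l → prodS (applyUpTo (λ t → X k (c ℕ.+ t)) (suc l)) ≗ shift (run c l) oneS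
  prodS-run c zero    v rewrite ℕₚ.+-identityʳ c = mono-⊛ (xExp c) oneS v
  prodS-run c (suc l) v = begin
    (X k (c ℕ.+ 0) ⊛ prodS (applyUpTo (λ t → X k (c ℕ.+ suc t)) (suc l))) v
      ≡⟨ cong₂ (λ d Xs → (X k d ⊛ prodS Xs) v) (ℕₚ.+-identityʳ c)
               (applyUpTo-cong (λ t → cong (X k) (ℕₚ.+-suc c t)) (suc l)) ⟩
    (X k c ⊛ Xs) v
      ≡⟨ mono-⊛ (xExp c) Xs v ⟩
    shift (xExp c) Xs v
      ≡⟨ shift-cong (xExp c) (prodS-run (suc c) l) v ⟩
    shift (xExp c) (shift (run (suc c) l) oneS) v
      ≡⟨ shift-+* (xExp c) (run (suc c) l) oneS v ⟨
    shift (run c (suc l)) oneS v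
      ∎
    where
    open ≡-Reasoning
    Xs = prodS (applyUpTo (λ t → X k (suc c ℕ.+ t)) (suc l))

  runs : ℕ → ℕ → Series (suc k)
  runs j d = ∑ˢ d (λ m → shift (run j m) (D m))

  runsH : Series (suc k)
  runsH = ∑ˢ k (λ a → runs (suc a) (k ∸ a))

  H⊛F≗runsH : H ⊛ F k ≗ runsH
  H⊛F≗runsH v = begin
    (H ⊛ F k) v
      ≡⟨ ⊛-congʳ H F-expand v ⟩
    (H ⊛ ∑ˢ k (λ i → ∑ˢ (suc i) (term i))) v
      ≡⟨ ⊛-∑ˢ H k (λ i → ∑ˢ (suc i) (term i)) v ⟩
    ∑ k (λ i → (H ⊛ ∑ˢ (suc i) (term i)) v)
      ≡⟨ ∑-cong k (λ i → trans (⊛-∑ˢ H (suc i) (term i) v) (∑-cong (suc i) (λ l → H⊛term i l v))) ⟩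
    ∑ k (λ i → ∑ (suc i) (λ l → shift (run (suc i ∸ l) l) (D l) v))
      ≡⟨ ∑-triangle k (λ j m → shift (run j m) (D m) v) ⟩
    runsH v
      ∎
    where
    open ≡-Reasoning
    term : ℕ → ℕ → Series (suc k)
    term i l = powS (W k ⊖ oneS) l ⊛ prodS (List.map (λ t → X k ((suc i ∸ l) ℕ.+ t)) (upTo (suc l)))
    F-expand : F k ≗ ∑ˢ k (λ i → ∑ˢ (suc i) (term i))
    F-expand u = trans (sumS-map-applyUpTo (λ i → sumS (List.map (term i) (upTo (suc i)))) id k u)
                       (∑-cong k (λ i → sumS-map-applyUpTo (term i) id (suc i) u))
    H⊛term : ∀ i l → H ⊛ term i l ≗ shift (run (suc i ∸ l) l) (D l)
    H⊛term i l u = begin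
      (H ⊛ (P ⊛ prodS (List.map x-run (upTo (suc l))))) u
        ≡⟨ ⊛-congʳ H (⊛-congʳ P (λ y → cong (λ Xs → prodS Xs y)
                                            (Listₚ.map-applyUpTo id x-run (suc l)))) u ⟩
      (H ⊛ (P ⊛ prodS (applyUpTo x-run (suc l)))) u
        ≡⟨ ⊛-congʳ H (⊛-congʳ P (prodS-run (suc i ∸ l) l)) u ⟩
      (H ⊛ (P ⊛ shift e oneS)) u
        ≡⟨ ⊛-congʳ H (λ y → trans (⊛-shift e P oneS y) (shift-cong e (⊛-identityʳ P) y)) u ⟩
      (H ⊛ shift e P) u
        ≡⟨ ⊛-shift e H P u ⟩
      shift e (D l) u
        ∎
      where
      P = powS (W k ⊖ oneS) l
      e = run (suc i ∸ l) l
      x-run : ℕ → Series (suc k)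
      x-run t = X k ((suc i ∸ l) ℕ.+ t)

  sum-unitExp : ∀ {a} → a ℕ.< k → Vec.sum (unitExp (suc a)) ≡ 1
  sum-unitExp {a} a<k = trans (sum-indicatorVec k a) (Boolₚ.if-cong (≤⇒≤ᵇ≡true a<k))

  sum-∸*-unitExp : ∀ {a} (n : Vec ℕ k) → a ℕ.< k → (unitExp (suc a) ≤ᵇ* n) ≡ true →
    Vec.sum (n ∸* unitExp (suc a)) ℕ.+ 1 ≡ Vec.sum n
  sum-∸*-unitExp {a} n a<k E≤n =
    trans (cong (Vec.sum (n ∸* unitExp (suc a)) ℕ.+_) (sym (sum-unitExp a<k)))
          (sum-∸*-+ (unitExp (suc a)) n E≤n)

  -- The letter a + 1 is the element a of Fin k.  succsFrom j w counts the successions of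
  -- w preceded by the letter j; since no letter follows k, succsFrom k = succs.
  succsFrom : ℕ → List (Fin k) → ℕ
  succsFrom j []      = 0
  succsFrom j (b ∷ w) = (if toℕ b ≡ᵇ j then 1 else 0) ℕ.+ succsFrom (suc (toℕ b)) w

  succs-∷ : ∀ a w → succs (a ∷ w) ≡ succsFrom (suc (toℕ a)) w
  succs-∷ a []      = refl
  succs-∷ a (b ∷ w) = cong ((if toℕ b ≡ᵇ suc (toℕ a) then 1 else 0) ℕ.+_) (succs-∷ b w)

  succs≡succsFrom-k : ∀ w → succs w ≡ succsFrom k w
  succs≡succsFrom-k []      = refl
  succs≡succsFrom-k (a ∷ w) rewrite dec-false (toℕ a ℕ.≟ k) (ℕₚ.<⇒≢ (Finₚ.toℕ<n a)) = succs-∷ a w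

  mult-[] : mult {k} [] ≡ 0*
  mult-[] = tabulate-0 k

  mult-∷ : ∀ a w → mult (a ∷ w) ≡ unitExp (suc (toℕ a)) +* mult w
  mult-∷ a w = trans (Vecₚ.tabulate-cong occ-∷) (sym (+*-tabulate _ _))
    where
    occ-∷ : ∀ p → occ p (a ∷ w) ≡ (if does (suc (toℕ p) ℕ.≟ suc (toℕ a)) then 1 else 0) ℕ.+ occ p w
    occ-∷ p with p Fin.≟ a
    ... | yes refl rewrite dec-true (toℕ p ℕ.≟ toℕ p) refl = refl
    ... | no p≢a   rewrite dec-false (toℕ p ℕ.≟ toℕ a) (p≢a ∘ Finₚ.toℕ-injective) = refl

  letterExp : ℕ → ℕ → Vec ℕ (suc k)
  letterExp j a = (if a ≡ᵇ j then 1 else 0) ∷ unitExp (suc a)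

  wordExp : ℕ → List (Fin k) → Vec ℕ (suc k)
  wordExp j w = succsFrom j w ∷ mult w

  wordExp-∷ : ∀ j b w → wordExp j (b ∷ w) ≡ letterExp j (toℕ b) +* wordExp (suc (toℕ b)) w
  wordExp-∷ j b w = cong (succsFrom j (b ∷ w) ∷_) (mult-∷ b w)

  wordsPoly : ℕ → ℕ → Series (suc k)
  wordsPoly j N = sumS (List.map (mono ∘ wordExp j) (words k N))

  wordsPoly-zero : ∀ j → wordsPoly j 0 ≗ oneS
  wordsPoly-zero j v = trans (ℤₚ.+-identityʳ _) (cong (λ n → mono (0 ∷ n) v) mult-[])

  wordsPoly-suc : ∀ j N →
    wordsPoly j (suc N) ≗ ∑ˢ k (λ a → shift (letterExp j a) (wordsPoly (suc a) N))
  wordsPoly-suc j N v = begin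
    sumS (List.map (mono ∘ wordExp j) (concatMap prefixed (allFin k))) v
      ≡⟨ sumS-map-concatMap (mono ∘ wordExp j) prefixed (allFin k) v ⟩
    sumS (List.map (λ b → sumS (List.map (mono ∘ wordExp j) (prefixed b))) (allFin k)) v
      ≡⟨ sumS-map-cong first-letter (allFin k) v ⟩
    sumS (List.map (λ b → shift (letterExp j (toℕ b)) (wordsPoly (suc (toℕ b)) N)) (allFin k)) v
      ≡⟨ sumS-map-allFin k (λ a → shift (letterExp j a) (wordsPoly (suc a) N)) v ⟩
    ∑ˢ k (λ a → shift (letterExp j a) (wordsPoly (suc a) N)) v
      ∎
    where
    open ≡-Reasoning
    prefixed : Fin k → List (List (Fin k))
    prefixed b = List.map (b ∷_) (words k N)
    first-letter : ∀ b → sumS (List.map (mono ∘ wordExp j) (prefixed b))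
                       ≗ shift (letterExp j (toℕ b)) (wordsPoly (suc (toℕ b)) N)
    first-letter b u = begin
      sumS (List.map (mono ∘ wordExp j) (prefixed b)) u
        ≡⟨ cong (λ As → sumS As u) (Listₚ.map-∘ (words k N)) ⟨
      sumS (List.map (mono ∘ wordExp j ∘ (b ∷_)) (words k N)) u
        ≡⟨ sumS-map-shift (letterExp j (toℕ b))
             (λ w y → trans (cong (λ e → mono e y) (wordExp-∷ j b w)) (mono-+* _ _ y)) (words k N) u ⟩
      shift (letterExp j (toℕ b)) (wordsPoly (suc (toℕ b)) N) u
        ∎

  -- Σ_N wordsPoly j N, of which only the term N = Vec.sum n contributes at (r ∷ n).
  wordsGF : ℕ → Series (suc k)
  wordsGF j (r ∷ n) = wordsPoly j (Vec.sum n) (r ∷ n)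

  wordsGF-0* : ∀ j r → wordsGF j (r ∷ 0*) ≡ oneS {suc k} (r ∷ 0*)
  wordsGF-0* j r rewrite sum-0* k = wordsPoly-zero j (r ∷ 0*)

  shift-letterExp-0* : ∀ j {a} (A : Series (suc k)) r → a ℕ.< k →
    shift (letterExp j a) A (r ∷ 0*) ≡ + 0
  shift-letterExp-0* j {a} A r a<k with unitExp (suc a) ≤ᵇ* 0* in E≤0
  ... | false rewrite Boolₚ.∧-zeroʳ ((if a ≡ᵇ j then 1 else 0) ≤ᵇ r) = refl
  ... | true  = contradiction (trans (sum-∸*-unitExp 0* a<k E≤0) (sum-0* k)) (ℕₚ.m+1+n≢0 _)

  shift-letterExp-wordsGF : ∀ j {a} i r n {N} → a ℕ.< k → Vec.sum n ≡ suc N →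
    shift (letterExp j a) (wordsGF i) (r ∷ n) ≡ shift (letterExp j a) (wordsPoly i N) (r ∷ n)
  shift-letterExp-wordsGF j {a} i r n a<k Σn≡1+N with unitExp (suc a) ≤ᵇ* n in E≤n
  ... | false rewrite Boolₚ.∧-zeroʳ ((if a ≡ᵇ j then 1 else 0) ≤ᵇ r) = refl
  ... | true  = Boolₚ.if-cong-then (((if a ≡ᵇ j then 1 else 0) ≤ᵇ r) ∧ true)
                  (cong (λ N → wordsPoly i N _) Σ[n∸E]≡N)
    where
    Σ[n∸E]≡N : Vec.sum (n ∸* unitExp (suc a)) ≡ _
    Σ[n∸E]≡N = ℕₚ.suc-injective (trans (ℕₚ.+-comm 1 _) (trans (sum-∸*-unitExp n a<k E≤n) Σn≡1+N))

  wordsGF-first-letter : ∀ j → wordsGF j ≗ oneS ⊕ ∑ˢ k (λ a → shift (letterExp j a) (wordsGF (suc a)))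
  wordsGF-first-letter j (r ∷ n) = by-length (Vec.sum n) refl
    where
    rest : Series (suc k)
    rest = ∑ˢ k (λ a → shift (letterExp j a) (wordsGF (suc a)))
    by-length : ∀ N → Vec.sum n ≡ N → wordsGF j (r ∷ n) ≡ oneS (r ∷ n) + rest (r ∷ n)
    by-length zero    Σn≡0   rewrite sum≡0⇒0* n Σn≡0 = begin
      wordsGF j (r ∷ 0*)                   ≡⟨ wordsGF-0* j r ⟩
      oneS (r ∷ 0* {k})                    ≡⟨ ℤₚ.+-identityʳ (oneS (r ∷ 0* {k})) ⟨
      oneS (r ∷ 0* {k}) + + 0              ≡⟨ cong (λ z → oneS (r ∷ 0* {k}) + z) rest≡0 ⟨
      oneS (r ∷ 0* {k}) + rest (r ∷ 0*)    ∎
      where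
      open ≡-Reasoning
      rest≡0 : rest (r ∷ 0*) ≡ + 0
      rest≡0 = trans (∑-congᵇ k (λ a a<k → shift-letterExp-0* j (wordsGF (suc a)) r a<k)) (∑-zero k)
    by-length (suc N) Σn≡1+N = begin
      wordsPoly j (Vec.sum n) (r ∷ n)
        ≡⟨ cong (λ N → wordsPoly j N (r ∷ n)) Σn≡1+N ⟩
      wordsPoly j (suc N) (r ∷ n)
        ≡⟨ wordsPoly-suc j N (r ∷ n) ⟩
      ∑ k (λ a → shift (letterExp j a) (wordsPoly (suc a) N) (r ∷ n))
        ≡⟨ ∑-congᵇ k (λ a a<k → shift-letterExp-wordsGF j (suc a) r n a<k Σn≡1+N) ⟨
      rest (r ∷ n)
        ≡⟨ ℤₚ.+-identityˡ _ ⟨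
      + 0 + rest (r ∷ n)
        ≡⟨ cong (_+ rest (r ∷ n)) (oneS-∷ r n n≢0) ⟨
      oneS (r ∷ n) + rest (r ∷ n)
        ∎
      where
      open ≡-Reasoning
      n≢0 : n ≢ 0*
      n≢0 n≡0 = ℕₚ.1+n≢0 (trans (sym Σn≡1+N) (trans (cong Vec.sum n≡0) (sum-0* k)))

  s≡wordsPoly : ∀ r n → + s k r n ≡ wordsPoly k (Vec.sum n) (r ∷ n)
  s≡wordsPoly r n = length-filter≡sumS _ (mono ∘ wordExp k) (r ∷ n) counted (words k (Vec.sum n))
    where
    counted : ∀ w → mono (wordExp k w) (r ∷ n)
                  ≡ (if does (succs w ℕ.≟ r) ∧ does (≡-dec ℕ._≟_ (mult w) n) then + 1 else + 0)
    counted w = Boolₚ.if-cong (cong₂ _∧_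
      (trans (does-sym ℕ._≟_ r (succsFrom k w)) (cong (λ t → does (t ℕ.≟ r)) (sym (succs≡succsFrom-k w))))
      (does-sym (≡-dec ℕ._≟_) n (mult w)))

  H≗wordsGF : H ≗ wordsGF k
  H≗wordsGF (r ∷ n) with ≡-dec ℕ._≟_ n 0*
  ... | yes refl = begin
    (if (r ≡ᵇ 0) ∧ true then + 1 else + 0) + + 0
      ≡⟨ ℤₚ.+-identityʳ _ ⟩
    (if (r ≡ᵇ 0) ∧ true then + 1 else + 0)
      ≡⟨ Boolₚ.if-cong (cong ((r ≡ᵇ 0) ∧_) (dec-true (≡-dec ℕ._≟_ (0* {k}) 0*) refl)) ⟨
    oneS (r ∷ 0* {k})
      ≡⟨ wordsGF-0* k r ⟨
    wordsGF k (r ∷ 0*)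
      ∎
    where open ≡-Reasoning
  ... | no _     rewrite Boolₚ.∧-zeroʳ (does (r ℕ.≟ 0)) = s≡wordsPoly r n

  -- The generating function of the words beginning with the letter a + 1.
  V : ℕ → Series (suc k)
  V a v = if a <ᵇ k then shift (xExp (suc a)) (wordsGF (suc a)) v else + 0

  V-< : ∀ {a} → a ℕ.< k → V a ≗ shift (xExp (suc a)) (wordsGF (suc a))
  V-< a<k v rewrite ≤⇒≤ᵇ≡true a<k = refl

  Δ-V-≥ : ∀ {a} → (a <ᵇ k) ≡ false → Δ (V a) ≗ zeroS
  Δ-V-≥ {a} a≮k v = cong₂ _-_ (trans (shift-cong wExp V≗0 v) (shift-zeroS wExp v)) (V≗0 v)
    where
    V≗0 : V a ≗ zeroS
    V≗0 u rewrite a≮k = refl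

  shift-letterExp : ∀ j a (A : Series (suc k)) v → shift (letterExp j a) A v
    ≡ (if a ≡ᵇ j then shift wExp (shift (xExp (suc a)) A) v else shift (xExp (suc a)) A v)
  shift-letterExp j a A v with a ≡ᵇ j
  ... | false = refl
  ... | true  = trans (cong (λ e → shift (1 ∷ e) A v) (sym (+*-identityˡ (unitExp (suc a)))))
                      (shift-+* wExp (xExp (suc a)) A v)

  -- Δ (V j) accounts for the succession between the preceding letter j and a first letter j + 1.
  wordsGF≗∑V : ∀ j → wordsGF j ≗ oneS ⊕ ∑ˢ k V ⊕ Δ (V j)
  wordsGF≗∑V j v = begin
    wordsGF j v
      ≡⟨ wordsGF-first-letter j v ⟩
    oneS v + ∑ k (λ a → shift (letterExp j a) (wordsGF (suc a)) v)
      ≡⟨ cong (λ z → oneS v + z) (∑-congᵇ k letter-term) ⟩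
    oneS v + ∑ k (λ a → if a ≡ᵇ j then shift wExp (V a) v else V a v)
      ≡⟨ cong (λ z → oneS v + z) (∑-update k j (λ a → shift wExp (V a) v) (λ a → V a v)) ⟩
    oneS v + (∑ˢ k V v + (if j <ᵇ k then Δ (V j) v else + 0))
      ≡⟨ cong (λ z → oneS v + (∑ˢ k V v + z)) (Δ-V (j <ᵇ k) refl) ⟩
    oneS v + (∑ˢ k V v + Δ (V j) v)
      ≡⟨ ℤₚ.+-assoc (oneS v) _ _ ⟨
    oneS v + ∑ˢ k V v + Δ (V j) v
      ∎
    where
    open ≡-Reasoning
    letter-term : ∀ a → a ℕ.< k → shift (letterExp j a) (wordsGF (suc a)) v
                                 ≡ (if a ≡ᵇ j then shift wExp (V a) v else V a v)
    letter-term a a<k = trans (shift-letterExp j a (wordsGF (suc a)) v)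
      (Boolₚ.if-cong₂ (a ≡ᵇ j) (shift-cong wExp (λ u → sym (V-< a<k u)) v) (sym (V-< a<k v)))
    Δ-V : ∀ b → (j <ᵇ k) ≡ b → (if b then Δ (V j) v else + 0) ≡ Δ (V j) v
    Δ-V true  _   = refl
    Δ-V false j≮k = sym (Δ-V-≥ j≮k v)

  H≗1⊕∑V : H ≗ oneS ⊕ ∑ˢ k V
  H≗1⊕∑V v = begin
    H v                                ≡⟨ H≗wordsGF v ⟩
    wordsGF k v                        ≡⟨ wordsGF≗∑V k v ⟩
    oneS v + ∑ˢ k V v + Δ (V k) v      ≡⟨ cong (λ z → oneS v + ∑ˢ k V v + z) (Δ-V-≥ k≮k v) ⟩
    oneS v + ∑ˢ k V v + + 0            ≡⟨ ℤₚ.+-identityʳ _ ⟩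
    oneS v + ∑ˢ k V v                  ∎
    where
    open ≡-Reasoning
    k≮k : (k <ᵇ k) ≡ false
    k≮k = >⇒≤ᵇ≡false (ℕₚ.n<1+n k)

  V-rec : ∀ {a} → a ℕ.< k → V a ≗ shift (xExp (suc a)) (H ⊕ Δ (V (suc a)))
  V-rec {a} a<k v = trans (V-< a<k v) (shift-cong (xExp (suc a)) wordsGF≗H⊕Δ v)
    where
    wordsGF≗H⊕Δ : wordsGF (suc a) ≗ H ⊕ Δ (V (suc a))
    wordsGF≗H⊕Δ u = trans (wordsGF≗∑V (suc a) u) (cong (_+ Δ (V (suc a)) u) (sym (H≗1⊕∑V u)))

  Δ-runs : ∀ j d → Δ (runs j d) ≗ ∑ˢ d (λ m → shift (run j m) (D (suc m)))
  Δ-runs j d v = begin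
    shift wExp (runs j d) v - runs j d v
      ≡⟨ cong (_- runs j d v) (shift-∑ˢ wExp d (λ m → shift (run j m) (D m)) v) ⟩
    ∑ d (λ m → shift wExp (shift (run j m) (D m)) v) - ∑ d (λ m → shift (run j m) (D m) v)
      ≡⟨ ∑-sub d _ _ ⟨
    ∑ d (λ m → Δ (shift (run j m) (D m)) v)
      ≡⟨ ∑-cong d Δ-term ⟩
    ∑ d (λ m → shift (run j m) (D (suc m)) v)
      ∎
    where
    open ≡-Reasoning
    Δ-term : ∀ m → Δ (shift (run j m) (D m)) v ≡ shift (run j m) (D (suc m)) v
    Δ-term m = begin
      shift wExp (shift (run j m) (D m)) v - shift (run j m) (D m) v
        ≡⟨ cong (_- shift (run j m) (D m) v) (shift-comm wExp (run j m) (D m) v) ⟩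
      shift (run j m) (shift wExp (D m)) v - shift (run j m) (D m) v
        ≡⟨ shift-⊖ (run j m) (shift wExp (D m)) (D m) v ⟨
      shift (run j m) (Δ (D m)) v
        ≡⟨ shift-cong (run j m) (λ u → sym (D-suc m u)) v ⟩
      shift (run j m) (D (suc m)) v
        ∎

  runs-rec : ∀ j d → runs j (suc d) ≗ shift (xExp j) (H ⊕ Δ (runs (suc j) d))
  runs-rec j d v = sym (begin
    shift (xExp j) (H ⊕ Δ (runs (suc j) d)) v
      ≡⟨ shift-⊕ (xExp j) H (Δ (runs (suc j) d)) v ⟩
    shift (xExp j) H v + shift (xExp j) (Δ (runs (suc j) d)) v
      ≡⟨ cong₂ _+_ (shift-cong (xExp j) (λ u → sym (⊛-identityʳ H u)) v)
                   (shift-cong (xExp j) (Δ-runs (suc j) d) v) ⟩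
    shift (xExp j) (D 0) v + shift (xExp j) (∑ˢ d later) v
      ≡⟨ cong (λ z → shift (xExp j) (D 0) v + z) (shift-∑ˢ (xExp j) d later v) ⟩
    shift (xExp j) (D 0) v + ∑ d (λ m → shift (xExp j) (later m) v)
      ≡⟨ cong (λ z → shift (xExp j) (D 0) v + z)
              (∑-cong d (λ m → sym (shift-+* (xExp j) (run (suc j) m) (D (suc m)) v))) ⟩
    runs j (suc d) v
      ∎)
    where
    open ≡-Reasoning
    later : ℕ → Series (suc k)
    later m = shift (run (suc j) m) (D (suc m))

  V≗runs : ∀ d a → d ℕ.+ a ≡ k → V a ≗ runs (suc a) d
  V≗runs zero    a a≡k v = V≗0 v
    where
    V≗0 : V a ≗ zeroS
    V≗0 u rewrite >⇒≤ᵇ≡false (ℕₚ.≤-reflexive (cong suc (sym a≡k))) = refl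
  V≗runs (suc d) a d+a≡k v = begin
    V a v
      ≡⟨ V-rec a<k v ⟩
    shift (xExp (suc a)) (H ⊕ Δ (V (suc a))) v
      ≡⟨ shift-cong (xExp (suc a)) (λ u → cong (λ z → H u + z)
                                               (cong₂ _-_ (shift-cong wExp IH u) (IH u))) v ⟩
    shift (xExp (suc a)) (H ⊕ Δ (runs (suc (suc a)) d)) v
      ≡⟨ runs-rec (suc a) d v ⟨
    runs (suc a) (suc d) v
      ∎
    where
    open ≡-Reasoning
    a<k : a ℕ.< k
    a<k = subst (a ℕ.<_) d+a≡k (ℕₚ.m<n+m a ℕ.z<s)
    IH : V (suc a) ≗ runs (suc (suc a)) d
    IH = V≗runs d (suc a) (trans (ℕₚ.+-suc d a) d+a≡k)

  H≗1⊕runsH : H ≗ oneS ⊕ runsH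
  H≗1⊕runsH v = trans (H≗1⊕∑V v) (cong (λ z → oneS v + z)
    (∑-congᵇ k (λ a a<k → V≗runs (k ∸ a) a (ℕₚ.m∸n+n≡m (ℕₚ.<⇒≤ a<k)) v)))

-- For k = 0 the identity holds as well (both G and F vanish).
corollary1 : (k : ℕ) → 1 ≤ k → (v : Vec ℕ (suc k)) →
    ((oneS ⊕ G k) ⊛ (oneS ⊖ F k)) v ≡ oneS v
corollary1 k _ v = begin
  (H k ⊛ (oneS ⊖ F k)) v               ≡⟨ ⊛-distribˡ-⊖ (H k) oneS (F k) v ⟩
  (H k ⊛ oneS) v - (H k ⊛ F k) v       ≡⟨ cong₂ _-_ (⊛-identityʳ (H k) v) (H⊛F≗runsH k v) ⟩
  H k v - runsH k v                    ≡⟨ cong (_- runsH k v) (H≗1⊕runsH k v) ⟩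
  oneS v + runsH k v - runsH k v       ≡⟨ +-minus-cancel (oneS v) (runsH k v) ⟩
  oneS v                               ∎
  where
  open ≡-Reasoning
  +-minus-cancel : ∀ (a b : ℤ) → a + b - b ≡ a
  +-minus-cancel = solve-∀
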